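{- For all integers $n\ge 2$ and $m\ge 3$, $\lambda_2(\overrightarrow{C}_n\Box \overleftrightarrow{C}_m)=3$.
   Context: $\overrightarrow{C}_n$ denotes the directed cycle of order $n$, and $\overleftrightarrow{C}_m$ denotes the symmetric digraph obtained from the undirected cycle of order $m$ by replacing each edge by the two opposite arcs. For a digraph $D$ and $S\subseteq V(D)$, an $S$-strong subgraph is a strongly connected subgraph of $D$ containing all vertices of $S$; $\lambda_S(D)$ is the maximum number of pairwise arc-disjoint $S$-strong subgraphs of $D$; and $\lambda_2(D)=\min\{\lambda_S(D): S\subseteq V(D),\ |S|=2\}$. The Cartesian product $G\Box H$ has vertex set $V(G)\times V(H)$, and $(x,x')(y,y')$ is an arc iff either $xy\in A(G)$ and $x'=y'$, or $x=y$ and $x'y'\in A(H)$. -}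

module Defs where

open import Level using (0ℓ)
open import Data.Nat using (ℕ; zero; suc; _≤_)
open import Data.Fin using (Fin; toℕ)
open import Data.Product using (Σ; _×_; _,_; ∃-syntax)
open import Data.Sum using (_⊎_)
open import Relation.Nullary using (¬_)
open import Relation.Binary.PropositionalEquality using (_≡_)
open import Relation.Binary.Construct.Closure.ReflexiveTransitive using (Star)

-- A digraph: a vertex type together with an arc relation
-- (arcs are identified by their ordered endpoint pairs; no parallel arcs).
record Digraph : Set₁ where
  field
    V   : Set
    Arc : V → V → Set
open Digraph public

record Subgraph (D : Digraph) : Set₁ where
  field
    SV   : V D → Set
    SArc : V D → V D → Set
    sub  : ∀ {x y} → SArc x y → Arc D x y × SV x × SV y
open Subgraph public

StronglyConnected : ∀ {D} → Subgraph D → Set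
StronglyConnected H = ∀ u v → SV H u → SV H v → Star (SArc H) u v

IsSStrong : ∀ {D} → (V D → Set) → Subgraph D → Set
IsSStrong S H = StronglyConnected H × (∀ x → S x → SV H x)

HasPacking : (D : Digraph) → (V D → Set) → ℕ → Set₁
HasPacking D S k =
  Σ (Fin k → Subgraph D) λ H →
    (∀ i → IsSStrong S (H i)) ×
    (∀ i j → ¬ (i ≡ j) → ∀ x y → ¬ (SArc (H i) x y × SArc (H j) x y))

IsLambdaS : (D : Digraph) → (V D → Set) → ℕ → Set₁
IsLambdaS D S k = HasPacking D S k × (∀ l → HasPacking D S l → l ≤ k)

Pair : ∀ {D} → V D → V D → V D → Set
Pair x y z = (z ≡ x) ⊎ (z ≡ y)

IsLambda2 : Digraph → ℕ → Set₁
IsLambda2 D k =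
  (∀ x y → ¬ (x ≡ y) → Σ ℕ λ l → IsLambdaS D (Pair {D} x y) l × k ≤ l) ×
  (Σ (V D) λ x → Σ (V D) λ y → ¬ (x ≡ y) × IsLambdaS D (Pair {D} x y) k)

DiCycle : ℕ → Digraph
DiCycle n = record
  { V = Fin n
  ; Arc = λ i j → (suc (toℕ i) ≡ toℕ j) ⊎ (suc (toℕ i) ≡ n × toℕ j ≡ 0) }

SymCycle : ℕ → Digraph
SymCycle m = record
  { V = Fin m
  ; Arc = λ i j → Arc (DiCycle m) i j ⊎ Arc (DiCycle m) j i }

_□_ : Digraph → Digraph → Digraph
G □ H = record
  { V = V G × V H
  ; Arc = λ { (x , x') (y , y') → (Arc G x y × x' ≡ y') ⊎ (x ≡ y × Arc H x' y') } }

-- Every vertex of C⃗ₙ □ C⃡ₘ has out-degree 3, and arc-disjoint strong subgraphs containing x ≠ y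
-- must leave x along distinct arcs, so λ_{x,y} ≤ 3. Conversely, the translations along both cycles
-- and the reflection j ↦ −j of C⃡ₘ preserve arcs, so it suffices to exhibit three arc-disjoint strong
-- subgraphs containing x = (0 , 0) and y = (a , b) with b ≠ m − 1. Each is described by the moves
-- it uses, and is strongly connected because every one of its arcs lies on a closed walk through a
-- fixed hub vertex.
module Submission where

open import Data.Nat as ℕ using (ℕ; zero; suc; _≤_; _<_; _∸_; _+_; z≤n; s≤s)
open import Data.Nat.Properties as ℕP using (suc-injective)
open import Data.Fin using (Fin; toℕ; fromℕ; inject₁; lower₁; opposite) renaming (zero to fz; suc to fs)
open import Data.Fin.Properties using (toℕ-injective; toℕ-fromℕ; toℕ-inject₁; toℕ-lower₁; toℕ<n; opposite-prop; opposite-involutive; injective⇒≤) renaming (_≟_ to _≟ᶠ_)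
open import Data.Product using (Σ; _×_; _,_; proj₁; proj₂)
open import Data.Sum using (_⊎_; inj₁; inj₂)
open import Data.Empty using (⊥; ⊥-elim)
open import Data.Unit using (⊤; tt)
open import Function using (_∘_; flip; id)
open import Relation.Nullary using (¬_; yes; no)
open import Relation.Binary.PropositionalEquality
open import Relation.Binary.Construct.Closure.ReflexiveTransitive using (Star; ε; _◅_; _◅◅_; gmap; reverse)

open import Defs

private
  variable
    k : ℕ

next : Fin (suc k) → Fin (suc k)
next {k} i with k ℕ.≟ toℕ i
... | yes _ = fz
... | no k≢i = fs (lower₁ i k≢i)

prev : Fin (suc k) → Fin (suc k)
prev {k} fz = fromℕ k
prev (fs i) = inject₁ i

toℕ≤pred : (i : Fin (suc k)) → toℕ i ≤ k
toℕ≤pred i = ℕP.≤-pred (toℕ<n i)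

≢fz⇒0< : {i : Fin (suc k)} → i ≢ fz → 0 < toℕ i
≢fz⇒0< {i = fz} i≢0 = ⊥-elim (i≢0 refl)
≢fz⇒0< {i = fs _} _ = s≤s z≤n

toℕ-next : (i : Fin (suc k)) → toℕ i < k → toℕ (next i) ≡ suc (toℕ i)
toℕ-next {k} i i<k with k ℕ.≟ toℕ i
... | yes k≡i = ⊥-elim (ℕP.<-irrefl (sym k≡i) i<k)
... | no k≢i = cong suc (toℕ-lower₁ i k≢i)

next-last : (i : Fin (suc k)) → toℕ i ≡ k → next i ≡ fz
next-last {k} i i≡k with k ℕ.≟ toℕ i
... | yes _ = refl
... | no k≢i = ⊥-elim (k≢i (sym i≡k))

next-fromℕ : next (fromℕ k) ≡ fz
next-fromℕ {k} = next-last (fromℕ k) (toℕ-fromℕ k)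

next-cases : (i : Fin (suc k)) →
             (toℕ i < k × toℕ (next i) ≡ suc (toℕ i)) ⊎ (toℕ i ≡ k × next i ≡ fz)
next-cases {k} i with toℕ i ℕ.<? k
... | yes i<k = inj₁ (i<k , toℕ-next i i<k)
... | no i≮k = inj₂ (i≡k , next-last i i≡k)
  where
  i≡k : toℕ i ≡ k
  i≡k = ℕP.≤-antisym (toℕ≤pred i) (ℕP.≮⇒≥ i≮k)

toℕ-prev : (i : Fin (suc k)) {t : ℕ} → toℕ i ≡ suc t → toℕ (prev i) ≡ t
toℕ-prev (fs i) i≡1+t = trans (toℕ-inject₁ i) (suc-injective i≡1+t)

toℕ-prev-pos : (j : Fin (suc k)) → 0 < toℕ j → suc (toℕ (prev j)) ≡ toℕ j
toℕ-prev-pos (fs j) _ = cong suc (toℕ-inject₁ j)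

next-prev : (i : Fin (suc k)) → next (prev i) ≡ i
next-prev {k} fz = next-fromℕ
next-prev {k} (fs i) = toℕ-injective (trans (toℕ-next (inject₁ i) i<k) (cong suc (toℕ-inject₁ i)))
  where
  i<k : toℕ (inject₁ i) < k
  i<k = subst (_< k) (sym (toℕ-inject₁ i)) (toℕ<n i)

prev-next : (i : Fin (suc k)) → prev (next i) ≡ i
prev-next {k} i with k ℕ.≟ toℕ i
... | yes k≡i = toℕ-injective (trans (toℕ-fromℕ k) k≡i)
... | no k≢i = toℕ-injective (trans (toℕ-inject₁ (lower₁ i k≢i)) (toℕ-lower₁ i k≢i))

next≢ : (i : Fin (suc (suc k))) → next i ≢ i
next≢ i next≡i with next-cases i
... | inj₁ (_ , n≡1+i) = ℕP.1+n≢n (trans (sym n≡1+i) (cong toℕ next≡i))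
... | inj₂ (i≡k , n≡0) = ℕP.1+n≢0 (trans (sym i≡k) (cong toℕ (trans (sym next≡i) n≡0)))

next²≢ : (i : Fin (suc (suc (suc k)))) → next (next i) ≢ i
next²≢ i nn≡i with next-cases i
... | inj₂ (i≡max , n≡0) =
  ℕP.1+n≢0 (suc-injective (trans (sym i≡max) (trans (cong toℕ (sym nn≡i)) (cong (toℕ ∘ next) n≡0))))
... | inj₁ (_ , n≡1+i) with next-cases (next i)
...   | inj₁ (_ , nn≡1+n) = ℕP.m≢1+n+m (toℕ i) {1} (trans (cong toℕ (sym nn≡i)) (trans nn≡1+n (cong suc n≡1+i)))
...   | inj₂ (n≡max , nn≡0) =
  ℕP.1+n≢0 (suc-injective (trans (sym n≡max) (trans n≡1+i (cong (suc ∘ toℕ) (trans (sym nn≡i) nn≡0)))))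

cycle-induction : ∀ {p} (P : Fin (suc k) → Set p) → P fz → (∀ i → P i → P (next i)) → ∀ i → P i
cycle-induction P P-zero P-next i = go (toℕ i) i refl
  where
  go : ∀ t i → toℕ i ≡ t → P i
  go zero i i≡0 = subst P (toℕ-injective (sym i≡0)) P-zero
  go (suc t) i i≡1+t = subst P (next-prev i) (P-next (prev i) (go t (prev i) (toℕ-prev i i≡1+t)))

opposite-next : (j : Fin (suc k)) → opposite (next j) ≡ prev (opposite j)
opposite-next {k} j with next-cases j
... | inj₁ (j<k , n≡1+j) = toℕ-injective (begin
  toℕ (opposite (next j))  ≡⟨ opposite-prop (next j) ⟩
  k ∸ toℕ (next j)         ≡⟨ cong (k ∸_) n≡1+j ⟩
  k ∸ suc (toℕ j)          ≡⟨ toℕ-prev (opposite j) (trans (opposite-prop j) (ℕP.+-∸-assoc 1 j<k)) ⟨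
  toℕ (prev (opposite j))  ∎)
  where open ≡-Reasoning
... | inj₂ (j≡k , n≡0) = trans (cong opposite n≡0) (cong prev (sym opposite≡0))
  where
  opposite≡0 : opposite j ≡ fz
  opposite≡0 = toℕ-injective (trans (opposite-prop j) (trans (cong (k ∸_) j≡k) (ℕP.n∸n≡0 k)))

-- j ↦ −j (mod k + 1): `opposite` is j ↦ k − j.
negate : Fin (suc k) → Fin (suc k)
negate j = next (opposite j)

negate-next : (j : Fin (suc k)) → negate (next j) ≡ prev (negate j)
negate-next j = trans (cong next (opposite-next j)) (trans (next-prev _) (sym (prev-next _)))

negate-involutive : (j : Fin (suc k)) → negate (negate j) ≡ j
negate-involutive j =
  trans (cong next (opposite-next (opposite j))) (trans (next-prev _) (opposite-involutive j))

negate-zero : negate {k} fz ≡ fz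
negate-zero = next-fromℕ

negate-one : negate {suc k} (fs fz) ≡ fromℕ (suc k)
negate-one {k} = toℕ-injective (begin
  toℕ (next (inject₁ (fromℕ k)))  ≡⟨ toℕ-next (inject₁ (fromℕ k)) (subst (_< suc k) (sym last≡k) (ℕP.n<1+n k)) ⟩
  suc (toℕ (inject₁ (fromℕ k)))   ≡⟨ cong suc last≡k ⟩
  suc k                          ≡⟨ toℕ-fromℕ (suc k) ⟨
  toℕ (fromℕ (suc k))            ∎)
  where
  open ≡-Reasoning
  last≡k : toℕ (inject₁ (fromℕ k)) ≡ k
  last≡k = trans (toℕ-inject₁ (fromℕ k)) (toℕ-fromℕ k)

next-arc : (i : Fin (suc k)) → Arc (DiCycle (suc k)) i (next i)
next-arc {k} i with k ℕ.≟ toℕ i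
... | yes k≡i = inj₂ (cong suc (sym k≡i) , refl)
... | no k≢i = inj₁ (cong suc (sym (toℕ-lower₁ i k≢i)))

arc⇒≡next : {i j : Fin (suc k)} → Arc (DiCycle (suc k)) i j → j ≡ next i
arc⇒≡next {k} {i} {j} arc with k ℕ.≟ toℕ i | arc
... | yes k≡i | inj₁ 1+i≡j = ⊥-elim (ℕP.<-irrefl refl (subst (_< suc k) (trans (sym 1+i≡j) (cong suc (sym k≡i))) (toℕ<n j)))
... | yes _   | inj₂ (_ , j≡0) = toℕ-injective j≡0
... | no k≢i  | inj₁ 1+i≡j = toℕ-injective (trans (sym 1+i≡j) (cong suc (sym (toℕ-lower₁ i k≢i))))
... | no k≢i  | inj₂ (1+i≡1+k , _) = ⊥-elim (k≢i (sym (suc-injective 1+i≡1+k)))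

prev-arc : (j : Fin (suc k)) → Arc (DiCycle (suc k)) (prev j) j
prev-arc j = subst (Arc (DiCycle _) (prev j)) (next-prev j) (next-arc (prev j))

next-preserves-arc : {i i′ : Fin (suc k)} → Arc (DiCycle (suc k)) i i′ → Arc (DiCycle (suc k)) (next i) (next i′)
next-preserves-arc {i = i} arc = subst (Arc (DiCycle _) (next i)) (cong next (sym (arc⇒≡next arc))) (next-arc (next i))

negate-reverses-arc : {j j′ : Fin (suc k)} → Arc (DiCycle (suc k)) j j′ → Arc (DiCycle (suc k)) (negate j′) (negate j)
negate-reverses-arc {j = j} arc =
  subst (λ z → Arc (DiCycle _) z (negate j)) (sym (trans (cong negate (arc⇒≡next arc)) (negate-next j))) (prev-arc (negate j))

module _ {r} (R : Fin (suc k) → Fin (suc k) → Set r) where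

  walk-up : ∀ p q → toℕ p ≤ toℕ q → (∀ i → toℕ p ≤ toℕ i → toℕ i < toℕ q → R i (next i)) → Star R p q
  walk-up p q p≤q = go (toℕ q ∸ toℕ p) p (sym (ℕP.m∸n+n≡m p≤q))
    where
    go : ∀ d p → toℕ q ≡ d + toℕ p → (∀ i → toℕ p ≤ toℕ i → toℕ i < toℕ q → R i (next i)) → Star R p q
    go zero p q≡p _ = subst (Star R p) (toℕ-injective (sym q≡p)) ε
    go (suc d) p q≡d+1+p steps = steps p ℕP.≤-refl p<q ◅ go d (next p) q≡d+next steps′
      where
      p<q : toℕ p < toℕ q
      p<q = subst (toℕ p <_) (sym q≡d+1+p) (s≤s (ℕP.m≤n+m (toℕ p) d))
      next≡ : toℕ (next p) ≡ suc (toℕ p)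
      next≡ = toℕ-next p (ℕP.<-≤-trans p<q (toℕ≤pred q))
      q≡d+next : toℕ q ≡ d + toℕ (next p)
      q≡d+next = trans q≡d+1+p (trans (sym (ℕP.+-suc d (toℕ p))) (cong (d +_) (sym next≡)))
      steps′ : ∀ i → toℕ (next p) ≤ toℕ i → toℕ i < toℕ q → R i (next i)
      steps′ i next≤i = steps i (ℕP.<⇒≤ (subst (_≤ toℕ i) next≡ next≤i))

  walk-around-next : (∀ i → R i (next i)) → ∀ p q → Star R p q
  walk-around-next steps p q =
    walk-up p (fromℕ k) (subst (toℕ p ≤_) (sym (toℕ-fromℕ k)) (toℕ≤pred p)) (λ i _ _ → steps i)
      ◅◅ subst (R (fromℕ k)) next-fromℕ (steps (fromℕ k))
      ◅ walk-up fz q z≤n (λ i _ _ → steps i)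

module _ {r} (R : Fin (suc k) → Fin (suc k) → Set r) where

  private
    prev-step : ∀ i → R (next i) (prev (next i)) → flip R i (next i)
    prev-step i = subst (R (next i)) (prev-next i)

  walk-down : ∀ p q → toℕ p ≤ toℕ q → (∀ i → toℕ p < toℕ i → toℕ i ≤ toℕ q → R i (prev i)) → Star R q p
  walk-down p q p≤q steps = reverse id (walk-up (flip R) p q p≤q steps′)
    where
    steps′ : ∀ i → toℕ p ≤ toℕ i → toℕ i < toℕ q → flip R i (next i)
    steps′ i p≤i i<q = prev-step i (steps (next i) (subst (toℕ p <_) (sym next≡) (s≤s p≤i)) (subst (_≤ toℕ q) (sym next≡) i<q))
      where
      next≡ : toℕ (next i) ≡ suc (toℕ i)
      next≡ = toℕ-next i (ℕP.<-≤-trans i<q (toℕ≤pred q))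

  walk-around-prev : (∀ i → R i (prev i)) → ∀ p q → Star R p q
  walk-around-prev steps p q = reverse id (walk-around-next (flip R) (λ i → prev-step i (steps (next i))) q p)

first-step : ∀ {a r} {A : Set a} {R : A → A → Set r} {x y} → x ≢ y → Star R x y → Σ A (R x)
first-step x≢x ε = ⊥-elim (x≢x refl)
first-step _ (step ◅ _) = _ , step

packing-size≤out-degree : (G : Digraph) {x y : V G} {d l : ℕ} → x ≢ y →
  (code : ∀ {w} → Arc G x w → Fin d) →
  (∀ {w w′} (a : Arc G x w) (a′ : Arc G x w′) → code a ≡ code a′ → w ≡ w′) →
  HasPacking G (Pair {G} x y) l → l ≤ d
packing-size≤out-degree G {x} {y} x≢y code code-injective (H , strong , disjoint) =
  injective⇒≤ {f = code ∘ out-arc} injective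
  where
  out-step : ∀ i → Σ (V G) (SArc (H i) x)
  out-step i = first-step x≢y (proj₁ (strong i) x y (proj₂ (strong i) x (inj₁ refl)) (proj₂ (strong i) y (inj₂ refl)))
  out-arc : ∀ i → Arc G x (proj₁ (out-step i))
  out-arc i = proj₁ (sub (H i) (proj₂ (out-step i)))
  injective : ∀ {i j} → code (out-arc i) ≡ code (out-arc j) → i ≡ j
  injective {i} {j} same-code with i ≟ᶠ j
  ... | yes i≡j = i≡j
  ... | no i≢j = ⊥-elim (disjoint i j i≢j x _ (proj₂ (out-step i) , shared))
    where
    shared : SArc (H j) x (proj₁ (out-step i))
    shared = subst (SArc (H j) x) (code-injective (out-arc j) (out-arc i) (sym same-code)) (proj₂ (out-step j))

record ArcPreservingBijection (G : Digraph) : Set where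
  field
    to from : V G → V G
    from-to : ∀ v → from (to v) ≡ v
    to-from : ∀ v → to (from v) ≡ v
    to-arc : ∀ {u v} → Arc G u v → Arc G (to u) (to v)

module _ {G : Digraph} (φ : ArcPreservingBijection G) where
  open ArcPreservingBijection φ

  image : Subgraph G → Subgraph G
  image H = record
    { SV = SV H ∘ from
    ; SArc = λ u v → Arc G u v × SArc H (from u) (from v)
    ; sub = λ (arc , h) → arc , proj₂ (sub H h)
    }

  image-stronglyConnected : ∀ H → StronglyConnected H → StronglyConnected (image H)
  image-stronglyConnected H strong u v u∈ v∈ =
    subst₂ (Star (SArc (image H))) (to-from u) (to-from v) (gmap to step (strong (from u) (from v) u∈ v∈))
    where
    step : ∀ {w w′} → SArc H w w′ → SArc (image H) (to w) (to w′)
    step {w} {w′} h = to-arc (proj₁ (sub H h)) , subst₂ (SArc H) (sym (from-to w)) (sym (from-to w′)) h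

  image-packing : ∀ {x y l} → HasPacking G (Pair {G} x y) l → HasPacking G (Pair {G} (to x) (to y)) l
  image-packing {x} {y} (H , strong , disjoint) =
    (λ i → image (H i)) ,
    (λ i → image-stronglyConnected (H i) (proj₁ (strong i)) , contains i) ,
    λ i j i≢j u v ((_ , hᵢ) , (_ , hⱼ)) → disjoint i j i≢j (from u) (from v) (hᵢ , hⱼ)
    where
    contains : ∀ i z → Pair {G} (to x) (to y) z → SV (H i) (from z)
    contains i z (inj₁ refl) = subst (SV (H i)) (sym (from-to x)) (proj₂ (strong i) x (inj₁ refl))
    contains i z (inj₂ refl) = subst (SV (H i)) (sym (from-to y)) (proj₂ (strong i) y (inj₂ refl))

  image-packings-from : ∀ {x l} → (∀ y → HasPacking G (Pair {G} x y) l) → ∀ y → HasPacking G (Pair {G} (to x) y) l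
  image-packings-from {x} {l} packings y =
    subst (λ z → HasPacking G (Pair {G} (to x) z) l) (to-from y) (image-packing (packings (from y)))

isLambda2-uniform : (G : Digraph) {k : ℕ} →
  (∀ x y → HasPacking G (Pair {G} x y) k) →
  (∀ {x y l} → x ≢ y → HasPacking G (Pair {G} x y) l → l ≤ k) →
  Σ (V G) (λ x → Σ (V G) λ y → x ≢ y) → IsLambda2 G k
isLambda2-uniform G packing bounded (x₀ , y₀ , x₀≢y₀) =
  (λ x y x≢y → _ , (packing x y , λ _ → bounded x≢y) , ℕP.≤-refl) ,
  (x₀ , y₀ , x₀≢y₀ , packing x₀ y₀ , λ _ → bounded x₀≢y₀)

-- Vertex (i , j) lies in row i and column j: columns are copies of C⃗ₙ, rows copies of C⃡ₘ.
module Torus (N M : ℕ) where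

  D : Digraph
  D = DiCycle (suc (suc N)) □ SymCycle (suc (suc (suc M)))

  Vertex : Set
  Vertex = V D

  out-code : ∀ {u v} → Arc D u v → Fin 3
  out-code (inj₁ _) = fz
  out-code (inj₂ (_ , inj₁ _)) = fs fz
  out-code (inj₂ (_ , inj₂ _)) = fs (fs fz)

  out-code-injective : ∀ {u v v′} (a : Arc D u v) (a′ : Arc D u v′) → out-code a ≡ out-code a′ → v ≡ v′
  out-code-injective {_ , j} (inj₁ (a , refl)) (inj₁ (a′ , refl)) _ =
    cong (_, j) (trans (arc⇒≡next a) (sym (arc⇒≡next a′)))
  out-code-injective {i , _} (inj₂ (refl , inj₁ a)) (inj₂ (refl , inj₁ a′)) _ =
    cong (i ,_) (trans (arc⇒≡next a) (sym (arc⇒≡next a′)))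
  out-code-injective {i , _} (inj₂ (refl , inj₂ a)) (inj₂ (refl , inj₂ a′)) _ =
    cong (i ,_) (trans (arc⇒≡prev a) (sym (arc⇒≡prev a′)))
    where
    arc⇒≡prev : ∀ {j j′ : Fin (suc (suc (suc M)))} → Arc (DiCycle _) j′ j → j′ ≡ prev j
    arc⇒≡prev {j} {j′} a = trans (sym (prev-next j′)) (cong prev (sym (arc⇒≡next a)))
  out-code-injective (inj₁ _) (inj₂ (_ , inj₁ _)) ()
  out-code-injective (inj₁ _) (inj₂ (_ , inj₂ _)) ()
  out-code-injective (inj₂ (_ , inj₁ _)) (inj₁ _) ()
  out-code-injective (inj₂ (_ , inj₁ _)) (inj₂ (_ , inj₂ _)) ()
  out-code-injective (inj₂ (_ , inj₂ _)) (inj₁ _) ()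
  out-code-injective (inj₂ (_ , inj₂ _)) (inj₂ (_ , inj₁ _)) ()

  packing-size≤3 : ∀ {x y l} → x ≢ y → HasPacking D (Pair {D} x y) l → l ≤ 3
  packing-size≤3 x≢y = packing-size≤out-degree D x≢y out-code out-code-injective

  data Move : Set where
    di cw ccw : Move

  move : Move → Vertex → Vertex
  move di (i , j) = next i , j
  move cw (i , j) = i , next j
  move ccw (i , j) = i , prev j

  move-arc : ∀ t u → Arc D u (move t u)
  move-arc di (i , j) = inj₁ (next-arc i , refl)
  move-arc cw (i , j) = inj₂ (refl , inj₁ (next-arc j))
  move-arc ccw (i , j) = inj₂ (refl , inj₂ (prev-arc j))

  move-injective : ∀ t s u → move t u ≡ move s u → t ≡ s
  move-injective di di _ _ = refl
  move-injective cw cw _ _ = refl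
  move-injective ccw ccw _ _ = refl
  move-injective di cw (i , _) e = ⊥-elim (next≢ i (cong proj₁ e))
  move-injective di ccw (i , _) e = ⊥-elim (next≢ i (cong proj₁ e))
  move-injective cw di (i , _) e = ⊥-elim (next≢ i (sym (cong proj₁ e)))
  move-injective ccw di (i , _) e = ⊥-elim (next≢ i (sym (cong proj₁ e)))
  move-injective cw ccw (_ , j) e = ⊥-elim (next²≢ j (trans (cong next (cong proj₂ e)) (next-prev j)))
  move-injective ccw cw (_ , j) e = ⊥-elim (next²≢ j (trans (cong next (sym (cong proj₂ e))) (next-prev j)))

  -- A subgraph is described by the moves out of each vertex that it uses.
  Labelling : Set₁
  Labelling = Move → Vertex → Set

  LArc : Labelling → Vertex → Vertex → Set
  LArc L u v = Σ Move λ t → L t u × v ≡ move t u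

  LVertex : Labelling → Vertex → Set
  LVertex L w = (Σ Move λ t → L t w) ⊎ (Σ Move λ t → Σ Vertex λ u → L t u × w ≡ move t u)

  subgraph : Labelling → Subgraph D
  subgraph L = record { SV = LVertex L ; SArc = LArc L ; sub = sub′ }
    where
    sub′ : ∀ {u v} → LArc L u v → Arc D u v × LVertex L u × LVertex L v
    sub′ {u} (t , l , refl) = move-arc t u , inj₁ (t , l) , inj₂ (t , u , l , refl)

  ThroughHub : Labelling → Vertex → Set
  ThroughHub L h = ∀ t u → L t u → Star (LArc L) h u × Star (LArc L) (move t u) h

  subgraph-stronglyConnected : ∀ L h → ThroughHub L h → StronglyConnected (subgraph L)
  subgraph-stronglyConnected L h through u v u∈ v∈ = to-hub u∈ ◅◅ from-hub v∈
    where
    to-hub : ∀ {w} → LVertex L w → Star (LArc L) w h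
    to-hub {w} (inj₁ (t , l)) = (t , l , refl) ◅ proj₂ (through t w l)
    to-hub (inj₂ (t , u , l , refl)) = proj₂ (through t u l)
    from-hub : ∀ {w} → LVertex L w → Star (LArc L) h w
    from-hub {w} (inj₁ (t , l)) = proj₁ (through t w l)
    from-hub (inj₂ (t , u , l , refl)) = proj₁ (through t u l) ◅◅ (t , l , refl) ◅ ε

  Disjoint : Labelling → Labelling → Set
  Disjoint L L′ = ∀ t u → L t u → L′ t u → ⊥

  disjoint-arcs : ∀ {L L′} → Disjoint L L′ → ∀ u v → ¬ (LArc L u v × LArc L′ u v)
  disjoint-arcs {L′ = L′} disjoint u v ((t , l , v≡) , (s , l′ , v≡′)) =
    disjoint t u l (subst (λ r → L′ r u) (sym (move-injective t s u (trans (sym v≡) v≡′))) l′)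

  record StrongLabelling (x y : Vertex) : Set₁ where
    field
      labels : Labelling
      hub : Vertex
      through-hub : ThroughHub labels hub
      x-out : Σ Move λ t → labels t x
      y-out : Σ Move λ t → labels t y

  open StrongLabelling

  strongLabelling-SStrong : ∀ {x y} (H : StrongLabelling x y) → IsSStrong (Pair {D} x y) (subgraph (labels H))
  strongLabelling-SStrong H = subgraph-stronglyConnected (labels H) (hub H) (through-hub H) , contains
    where
    contains : ∀ z → Pair {D} _ _ z → LVertex (labels H) z
    contains z (inj₁ refl) = inj₁ (x-out H)
    contains z (inj₂ refl) = inj₁ (y-out H)

  packing-of-three : ∀ {x y} (H₁ H₂ H₃ : StrongLabelling x y) →
    Disjoint (labels H₁) (labels H₂) → Disjoint (labels H₁) (labels H₃) → Disjoint (labels H₂) (labels H₃) →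
    HasPacking D (Pair {D} x y) 3
  packing-of-three {x} {y} H₁ H₂ H₃ d₁₂ d₁₃ d₂₃ =
    (λ i → subgraph (labels (H i))) , (λ i → strongLabelling-SStrong (H i)) ,
    λ i j i≢j → disjoint-arcs (disjoint i j i≢j)
    where
    H : Fin 3 → StrongLabelling x y
    H fz = H₁
    H (fs fz) = H₂
    H (fs (fs fz)) = H₃
    flip-disjoint : ∀ {L L′} → Disjoint L L′ → Disjoint L′ L
    flip-disjoint d t u l′ l = d t u l l′
    disjoint : ∀ i j → i ≢ j → Disjoint (labels (H i)) (labels (H j))
    disjoint fz (fs fz) _ = d₁₂
    disjoint fz (fs (fs fz)) _ = d₁₃
    disjoint (fs fz) (fs (fs fz)) _ = d₂₃
    disjoint (fs fz) fz _ = flip-disjoint d₁₂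
    disjoint (fs (fs fz)) fz _ = flip-disjoint d₁₃
    disjoint (fs (fs fz)) (fs fz) _ = flip-disjoint d₂₃
    disjoint fz fz i≢i = ⊥-elim (i≢i refl)
    disjoint (fs fz) (fs fz) i≢i = ⊥-elim (i≢i refl)
    disjoint (fs (fs fz)) (fs (fs fz)) i≢i = ⊥-elim (i≢i refl)

  module _ (L : Labelling) where

    private
      Walk = Star (LArc L)

    single : ∀ t u → L t u → Walk u (move t u)
    single t u l = (t , l , refl) ◅ ε

    column-around : ∀ j → (∀ i → L di (i , j)) → ∀ p q → Walk (p , j) (q , j)
    column-around j steps p q =
      gmap (_, j) id (walk-around-next (λ i i′ → LArc L (i , j) (i′ , j)) (λ i → di , steps i , refl) p q)

    row-around-cw : ∀ i → (∀ j → L cw (i , j)) → ∀ p q → Walk (i , p) (i , q)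
    row-around-cw i steps p q =
      gmap (i ,_) id (walk-around-next (λ j j′ → LArc L (i , j) (i , j′)) (λ j → cw , steps j , refl) p q)

    row-around-ccw : ∀ i → (∀ j → L ccw (i , j)) → ∀ p q → Walk (i , p) (i , q)
    row-around-ccw i steps p q =
      gmap (i ,_) id (walk-around-prev (λ j j′ → LArc L (i , j) (i , j′)) (λ j → ccw , steps j , refl) p q)

    column-up : ∀ j p q → toℕ p ≤ toℕ q → (∀ i → toℕ p ≤ toℕ i → toℕ i < toℕ q → L di (i , j)) →
                Walk (p , j) (q , j)
    column-up j p q p≤q steps =
      gmap (_, j) id (walk-up (λ i i′ → LArc L (i , j) (i′ , j)) p q p≤q (λ i p≤i i<q → di , steps i p≤i i<q , refl))

    row-up : ∀ i p q → toℕ p ≤ toℕ q → (∀ j → toℕ p ≤ toℕ j → toℕ j < toℕ q → L cw (i , j)) →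
             Walk (i , p) (i , q)
    row-up i p q p≤q steps =
      gmap (i ,_) id (walk-up (λ j j′ → LArc L (i , j) (i , j′)) p q p≤q (λ j p≤j j<q → cw , steps j p≤j j<q , refl))

    row-down : ∀ i p q → toℕ p ≤ toℕ q → (∀ j → toℕ p < toℕ j → toℕ j ≤ toℕ q → L ccw (i , j)) →
               Walk (i , q) (i , p)
    row-down i p q p≤q steps =
      gmap (i ,_) id (walk-down (λ j j′ → LArc L (i , j) (i , j′)) p q p≤q (λ j p<j j≤q → ccw , steps j p<j j≤q , refl))

  origin : Vertex
  origin = fz , fz

  last-row : Fin (suc (suc N))
  last-row = fromℕ (suc N)

  last-column : Fin (suc (suc (suc M)))
  last-column = fromℕ (suc (suc M))

  module SameRow (b : Fin (suc (suc (suc M)))) where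

    L₁ L₂ L₃ : Labelling
    L₁ cw (i , _) = i ≡ fz
    L₁ _ _ = ⊥
    L₂ ccw (i , _) = i ≡ fz
    L₂ _ _ = ⊥
    L₃ di _ = ⊤
    L₃ cw (i , _) = i ≡ fs fz
    L₃ ccw _ = ⊥

    H₁ : StrongLabelling origin (fz , b)
    H₁ = record { labels = L₁ ; hub = origin ; through-hub = through ; x-out = cw , refl ; y-out = cw , refl }
      where
      through : ThroughHub L₁ origin
      through cw (_ , j) refl = row-around-cw L₁ fz (λ _ → refl) fz j , row-around-cw L₁ fz (λ _ → refl) (next j) fz

    H₂ : StrongLabelling origin (fz , b)
    H₂ = record { labels = L₂ ; hub = origin ; through-hub = through ; x-out = ccw , refl ; y-out = ccw , refl }
      where
      through : ThroughHub L₂ origin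
      through ccw (_ , j) refl = row-around-ccw L₂ fz (λ _ → refl) fz j , row-around-ccw L₂ fz (λ _ → refl) (prev j) fz

    H₃ : StrongLabelling origin (fz , b)
    H₃ = record { labels = L₃ ; hub = hub₃ ; through-hub = λ t u _ → from-hub u , to-hub (move t u) ; x-out = di , tt ; y-out = di , tt }
      where
      hub₃ : Vertex
      hub₃ = fs fz , fz
      from-hub : ∀ w → Star (LArc L₃) hub₃ w
      from-hub (i , j) = row-around-cw L₃ (fs fz) (λ _ → refl) fz j ◅◅ column-around L₃ j (λ _ → tt) (fs fz) i
      to-hub : ∀ w → Star (LArc L₃) w hub₃
      to-hub (i , j) = column-around L₃ j (λ _ → tt) i (fs fz) ◅◅ row-around-cw L₃ (fs fz) (λ _ → refl) j fz

    packing : HasPacking D (Pair {D} origin (fz , b)) 3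
    packing = packing-of-three H₁ H₂ H₃ (λ { cw _ _ () }) (λ { cw _ refl () }) (λ { ccw _ _ () })

  module SameColumn (a : Fin (suc (suc N))) where

    L₁ L₂ L₃ : Labelling
    L₁ di (_ , j) = j ≡ fz
    L₁ _ _ = ⊥
    L₂ di (_ , j) = j ≡ fs fz
    L₂ cw (_ , j) = j ≡ fz
    L₂ ccw (_ , j) = j ≡ fs fz
    L₃ di (_ , j) = j ≡ last-column
    L₃ cw (_ , j) = j ≡ last-column
    L₃ ccw (_ , j) = j ≡ fz

    H₁ : StrongLabelling origin (a , fz)
    H₁ = record { labels = L₁ ; hub = origin ; through-hub = through ; x-out = di , refl ; y-out = di , refl }
      where
      through : ThroughHub L₁ origin
      through di (i , _) refl = column-around L₁ fz (λ _ → refl) fz i , column-around L₁ fz (λ _ → refl) (next i) fz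

    H₂ : StrongLabelling origin (a , fz)
    H₂ = record { labels = L₂ ; hub = fz , fs fz ; through-hub = through ; x-out = cw , refl ; y-out = cw , refl }
      where
      from-hub : ∀ i → Star (LArc L₂) (fz , fs fz) (i , fs fz)
      from-hub = column-around L₂ (fs fz) (λ _ → refl) fz
      to-hub : ∀ i → Star (LArc L₂) (i , fs fz) (fz , fs fz)
      to-hub i = column-around L₂ (fs fz) (λ _ → refl) i fz
      through : ThroughHub L₂ (fz , fs fz)
      through di (i , _) refl = from-hub i , to-hub (next i)
      through cw (i , _) refl = from-hub i ◅◅ single L₂ ccw (i , fs fz) refl , to-hub i
      through ccw (i , _) refl = from-hub i , single L₂ cw (i , fz) refl ◅◅ to-hub i

    H₃ : StrongLabelling origin (a , fz)
    H₃ = record { labels = L₃ ; hub = fz , last-column ; through-hub = through ; x-out = ccw , refl ; y-out = ccw , refl }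
      where
      from-hub : ∀ i → Star (LArc L₃) (fz , last-column) (i , last-column)
      from-hub = column-around L₃ last-column (λ _ → refl) fz
      to-hub : ∀ i → Star (LArc L₃) (i , last-column) (fz , last-column)
      to-hub i = column-around L₃ last-column (λ _ → refl) i fz
      wrap : ∀ i → Star (LArc L₃) (i , last-column) (i , fz)
      wrap i = subst (Star (LArc L₃) (i , last-column) ∘ (i ,_)) next-fromℕ (single L₃ cw (i , last-column) refl)
      through : ThroughHub L₃ (fz , last-column)
      through di (i , _) refl = from-hub i , to-hub (next i)
      through cw (i , _) refl =
        from-hub i , subst (λ j → Star (LArc L₃) (i , j) (fz , last-column)) (sym next-fromℕ) (single L₃ ccw (i , fz) refl ◅◅ to-hub i)
      through ccw (i , _) refl = from-hub i ◅◅ wrap i , to-hub i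

    packing : HasPacking D (Pair {D} origin (a , fz)) 3
    packing = packing-of-three H₁ H₂ H₃
      (λ { di _ refl () })
      (λ { di _ refl () })
      (λ { di _ refl () ; cw _ refl () ; ccw _ refl () })

  ≤last-row : ∀ i → toℕ i ≤ toℕ last-row
  ≤last-row i = subst (toℕ i ≤_) (sym (toℕ-fromℕ _)) (toℕ≤pred i)

  ≤last-column : ∀ j → toℕ j ≤ toℕ last-column
  ≤last-column j = subst (toℕ j ≤_) (sym (toℕ-fromℕ _)) (toℕ≤pred j)

  module Generic (a : Fin (suc (suc N))) (b : Fin (suc (suc (suc M))))
                 (a≢0 : a ≢ fz) (b≢0 : b ≢ fz) (b<last : toℕ b < suc (suc M)) where

    A B : ℕ
    A = toℕ a
    B = toℕ b

    A≤last : A ≤ toℕ last-row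
    A≤last = ≤last-row a

    toℕ-next-row : ∀ i → toℕ i < A → toℕ (next i) ≡ suc (toℕ i)
    toℕ-next-row i i<A = toℕ-next i (ℕP.<-≤-trans i<A (toℕ≤pred a))

    toℕ-next-column : ∀ j → toℕ j < B → toℕ (next j) ≡ suc (toℕ j)
    toℕ-next-column j j<B = toℕ-next j (ℕP.<-trans j<B b<last)

    prev≤B : ∀ (j : Fin (suc (suc (suc M)))) → 0 < toℕ j → toℕ j ≤ B → toℕ (prev j) ≤ B
    prev≤B j 0<j j≤B = ℕP.≤-trans (ℕP.n≤1+n _) (subst (_≤ B) (sym (toℕ-prev-pos j 0<j)) j≤B)

    b≢last : b ≢ last-column
    b≢last b≡last = ℕP.<-irrefl (trans (cong toℕ b≡last) (toℕ-fromℕ _)) b<last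

    -- The cycle origin → (0 , b) → (a , b) → (a , 0) → (n − 1 , 0) → origin.
    L₁ : Labelling
    L₁ di (i , j) = (j ≡ b × toℕ i < A) ⊎ (j ≡ fz × A ≤ toℕ i)
    L₁ cw (i , j) = i ≡ fz × toℕ j < B
    L₁ ccw (i , j) = i ≡ a × 0 < toℕ j × toℕ j ≤ B

    H₁ : StrongLabelling origin (a , b)
    H₁ = record { labels = L₁ ; hub = origin ; through-hub = through
                ; x-out = cw , refl , ≢fz⇒0< b≢0 ; y-out = ccw , refl , ≢fz⇒0< b≢0 , ℕP.≤-refl }
      where
      Walk = Star (LArc L₁)
      along-row₀ : ∀ p q → toℕ p ≤ toℕ q → toℕ q ≤ B → Walk (fz , p) (fz , q)
      along-row₀ p q p≤q q≤B = row-up L₁ fz p q p≤q (λ _ _ j<q → refl , ℕP.<-≤-trans j<q q≤B)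
      along-column-b : ∀ p q → toℕ p ≤ toℕ q → toℕ q ≤ A → Walk (p , b) (q , b)
      along-column-b p q p≤q q≤A = column-up L₁ b p q p≤q (λ _ _ i<q → inj₁ (refl , ℕP.<-≤-trans i<q q≤A))
      back-row-a : ∀ p q → toℕ p ≤ toℕ q → toℕ q ≤ B → Walk (a , q) (a , p)
      back-row-a p q p≤q q≤B = row-down L₁ a p q p≤q (λ _ p<j j≤q → refl , ℕP.≤-<-trans z≤n p<j , ℕP.≤-trans j≤q q≤B)
      along-column₀ : ∀ p q → A ≤ toℕ p → toℕ p ≤ toℕ q → Walk (p , fz) (q , fz)
      along-column₀ p q A≤p p≤q = column-up L₁ fz p q p≤q (λ _ p≤i _ → inj₂ (refl , ℕP.≤-trans A≤p p≤i))
      wrap : Walk (last-row , fz) origin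
      wrap = subst (λ i → Walk (last-row , fz) (i , fz)) next-fromℕ (single L₁ di (last-row , fz) (inj₂ (refl , A≤last)))

      column₀⇝o : ∀ p → A ≤ toℕ p → Walk (p , fz) origin
      column₀⇝o p A≤p = along-column₀ p last-row A≤p (≤last-row p) ◅◅ wrap
      row-a⇝o : ∀ q → toℕ q ≤ B → Walk (a , q) origin
      row-a⇝o q q≤B = back-row-a fz q z≤n q≤B ◅◅ column₀⇝o a ℕP.≤-refl
      column-b⇝o : ∀ p → toℕ p ≤ A → Walk (p , b) origin
      column-b⇝o p p≤A = along-column-b p a p≤A ℕP.≤-refl ◅◅ row-a⇝o b ℕP.≤-refl
      row₀⇝o : ∀ p → toℕ p ≤ B → Walk (fz , p) origin
      row₀⇝o p p≤B = along-row₀ p b p≤B ℕP.≤-refl ◅◅ column-b⇝o fz z≤n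

      o⇝row₀ : ∀ q → toℕ q ≤ B → Walk origin (fz , q)
      o⇝row₀ q q≤B = along-row₀ fz q z≤n q≤B
      o⇝column-b : ∀ q → toℕ q ≤ A → Walk origin (q , b)
      o⇝column-b q q≤A = o⇝row₀ b ℕP.≤-refl ◅◅ along-column-b fz q z≤n q≤A
      o⇝row-a : ∀ p → toℕ p ≤ B → Walk origin (a , p)
      o⇝row-a p p≤B = o⇝column-b a ℕP.≤-refl ◅◅ back-row-a p b p≤B ℕP.≤-refl
      o⇝column₀ : ∀ q → A ≤ toℕ q → Walk origin (q , fz)
      o⇝column₀ q A≤q = o⇝row-a fz z≤n ◅◅ along-column₀ a q ℕP.≤-refl A≤q

      through : ThroughHub L₁ origin
      through di (i , _) (inj₁ (refl , i<A)) =
        o⇝column-b i (ℕP.<⇒≤ i<A) , column-b⇝o (next i) (subst (_≤ A) (sym (toℕ-next-row i i<A)) i<A)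
      through di (i , _) (inj₂ (refl , A≤i)) with next-cases i
      ... | inj₁ (_ , next≡) = o⇝column₀ i A≤i , column₀⇝o (next i) (subst (A ≤_) (sym next≡) (ℕP.m≤n⇒m≤1+n A≤i))
      ... | inj₂ (_ , next≡0) = o⇝column₀ i A≤i , subst (λ i′ → Walk (i′ , fz) origin) (sym next≡0) ε
      through cw (_ , j) (refl , j<B) =
        o⇝row₀ j (ℕP.<⇒≤ j<B) , row₀⇝o (next j) (subst (_≤ B) (sym (toℕ-next-column j j<B)) j<B)
      through ccw (_ , j) (refl , 0<j , j≤B) = o⇝row-a j j≤B , row-a⇝o (prev j) (prev≤B j 0<j j≤B)

    -- The cycle origin → (a , 0) → (a , b) → (n − 1 , b) → (0 , b) → origin.
    L₂ : Labelling
    L₂ di (i , j) = (j ≡ fz × toℕ i < A) ⊎ (j ≡ b × A ≤ toℕ i)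
    L₂ cw (i , j) = i ≡ a × toℕ j < B
    L₂ ccw (i , j) = i ≡ fz × 0 < toℕ j × toℕ j ≤ B

    H₂ : StrongLabelling origin (a , b)
    H₂ = record { labels = L₂ ; hub = origin ; through-hub = through
                ; x-out = di , inj₁ (refl , ≢fz⇒0< a≢0) ; y-out = di , inj₂ (refl , ℕP.≤-refl) }
      where
      Walk = Star (LArc L₂)
      along-column₀ : ∀ p q → toℕ p ≤ toℕ q → toℕ q ≤ A → Walk (p , fz) (q , fz)
      along-column₀ p q p≤q q≤A = column-up L₂ fz p q p≤q (λ _ _ i<q → inj₁ (refl , ℕP.<-≤-trans i<q q≤A))
      along-row-a : ∀ p q → toℕ p ≤ toℕ q → toℕ q ≤ B → Walk (a , p) (a , q)
      along-row-a p q p≤q q≤B = row-up L₂ a p q p≤q (λ _ _ j<q → refl , ℕP.<-≤-trans j<q q≤B)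
      along-column-b : ∀ p q → A ≤ toℕ p → toℕ p ≤ toℕ q → Walk (p , b) (q , b)
      along-column-b p q A≤p p≤q = column-up L₂ b p q p≤q (λ _ p≤i _ → inj₂ (refl , ℕP.≤-trans A≤p p≤i))
      back-row₀ : ∀ p q → toℕ p ≤ toℕ q → toℕ q ≤ B → Walk (fz , q) (fz , p)
      back-row₀ p q p≤q q≤B = row-down L₂ fz p q p≤q (λ _ p<j j≤q → refl , ℕP.≤-<-trans z≤n p<j , ℕP.≤-trans j≤q q≤B)
      wrap : Walk (last-row , b) (fz , b)
      wrap = subst (λ i → Walk (last-row , b) (i , b)) next-fromℕ (single L₂ di (last-row , b) (inj₂ (refl , A≤last)))

      row₀⇝o : ∀ q → toℕ q ≤ B → Walk (fz , q) origin
      row₀⇝o q q≤B = back-row₀ fz q z≤n q≤B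
      column-b⇝o : ∀ p → A ≤ toℕ p → Walk (p , b) origin
      column-b⇝o p A≤p = along-column-b p last-row A≤p (≤last-row p) ◅◅ wrap ◅◅ row₀⇝o b ℕP.≤-refl
      row-a⇝o : ∀ p → toℕ p ≤ B → Walk (a , p) origin
      row-a⇝o p p≤B = along-row-a p b p≤B ℕP.≤-refl ◅◅ column-b⇝o a ℕP.≤-refl
      column₀⇝o : ∀ p → toℕ p ≤ A → Walk (p , fz) origin
      column₀⇝o p p≤A = along-column₀ p a p≤A ℕP.≤-refl ◅◅ row-a⇝o fz z≤n

      o⇝column₀ : ∀ q → toℕ q ≤ A → Walk origin (q , fz)
      o⇝column₀ q q≤A = along-column₀ fz q z≤n q≤A
      o⇝row-a : ∀ q → toℕ q ≤ B → Walk origin (a , q)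
      o⇝row-a q q≤B = o⇝column₀ a ℕP.≤-refl ◅◅ along-row-a fz q z≤n q≤B
      o⇝column-b : ∀ q → A ≤ toℕ q → Walk origin (q , b)
      o⇝column-b q A≤q = o⇝row-a b ℕP.≤-refl ◅◅ along-column-b a q ℕP.≤-refl A≤q
      o⇝row₀ : ∀ p → toℕ p ≤ B → Walk origin (fz , p)
      o⇝row₀ p p≤B = o⇝column-b last-row A≤last ◅◅ wrap ◅◅ back-row₀ p b p≤B ℕP.≤-refl

      through : ThroughHub L₂ origin
      through di (i , _) (inj₁ (refl , i<A)) =
        o⇝column₀ i (ℕP.<⇒≤ i<A) , column₀⇝o (next i) (subst (_≤ A) (sym (toℕ-next-row i i<A)) i<A)
      through di (i , _) (inj₂ (refl , A≤i)) with next-cases i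
      ... | inj₁ (_ , next≡) = o⇝column-b i A≤i , column-b⇝o (next i) (subst (A ≤_) (sym next≡) (ℕP.m≤n⇒m≤1+n A≤i))
      ... | inj₂ (_ , next≡0) = o⇝column-b i A≤i , subst (λ i′ → Walk (i′ , b) origin) (sym next≡0) (row₀⇝o b ℕP.≤-refl)
      through cw (_ , j) (refl , j<B) =
        o⇝row-a j (ℕP.<⇒≤ j<B) , row-a⇝o (next j) (subst (_≤ B) (sym (toℕ-next-column j j<B)) j<B)
      through ccw (_ , j) (refl , 0<j , j≤B) = o⇝row₀ j j≤B , row₀⇝o (prev j) (prev≤B j 0<j j≤B)

    -- The last column, the two arcs between origin and (0 , m − 1), and row a between columns b and m − 1 in both directions.
    L₃ : Labelling
    L₃ di (_ , j) = j ≡ last-column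
    L₃ cw (i , j) = (i ≡ fz × j ≡ last-column) ⊎ (i ≡ a × B ≤ toℕ j × toℕ j < suc (suc M))
    L₃ ccw (i , j) = (i ≡ fz × j ≡ fz) ⊎ (i ≡ a × B < toℕ j)

    H₃ : StrongLabelling origin (a , b)
    H₃ = record { labels = L₃ ; hub = hub₃ ; through-hub = through
                ; x-out = ccw , inj₁ (refl , refl) ; y-out = cw , inj₂ (refl , ℕP.≤-refl , b<last) }
      where
      Walk = Star (LArc L₃)
      hub₃ : Vertex
      hub₃ = fz , last-column
      last-column-around : ∀ p q → Walk (p , last-column) (q , last-column)
      last-column-around = column-around L₃ last-column (λ _ → refl)
      hub⇝o : Walk hub₃ origin
      hub⇝o = subst (Walk hub₃ ∘ (fz ,_)) next-fromℕ (single L₃ cw hub₃ (inj₁ (refl , refl)))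
      o⇝hub : Walk origin hub₃
      o⇝hub = single L₃ ccw origin (inj₁ (refl , refl))
      up-row-a : ∀ p → B ≤ toℕ p → Walk (a , p) (a , last-column)
      up-row-a p B≤p = row-up L₃ a p last-column (≤last-column p)
        (λ j p≤j j<last → inj₂ (refl , ℕP.≤-trans B≤p p≤j , subst (toℕ j <_) (toℕ-fromℕ _) j<last))
      down-row-a : ∀ p → B ≤ toℕ p → Walk (a , last-column) (a , p)
      down-row-a p B≤p = row-down L₃ a p last-column (≤last-column p) (λ _ p<j _ → inj₂ (refl , ℕP.≤-<-trans B≤p p<j))
      hub⇝row-a : ∀ p → B ≤ toℕ p → Walk hub₃ (a , p)
      hub⇝row-a p B≤p = last-column-around fz a ◅◅ down-row-a p B≤p
      row-a⇝hub : ∀ p → B ≤ toℕ p → Walk (a , p) hub₃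
      row-a⇝hub p B≤p = up-row-a p B≤p ◅◅ last-column-around a fz

      through : ThroughHub L₃ hub₃
      through di (i , _) refl = last-column-around fz i , last-column-around (next i) fz
      through cw (_ , _) (inj₁ (refl , refl)) = ε , subst (λ j → Walk (fz , j) hub₃) (sym next-fromℕ) o⇝hub
      through cw (_ , j) (inj₂ (refl , B≤j , j<last)) =
        hub⇝row-a j B≤j , row-a⇝hub (next j) (subst (B ≤_) (sym (toℕ-next j j<last)) (ℕP.m≤n⇒m≤1+n B≤j))
      through ccw (_ , _) (inj₁ (refl , refl)) = hub⇝o , ε
      through ccw (_ , j) (inj₂ (refl , B<j)) =
        hub⇝row-a j (ℕP.<⇒≤ B<j) , row-a⇝hub (prev j) (ℕP.≤-pred (subst (B <_) (sym (toℕ-prev-pos j (ℕP.≤-<-trans z≤n B<j))) B<j))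

    disjoint₁₂ : Disjoint L₁ L₂
    disjoint₁₂ di _ (inj₁ (refl , _)) (inj₁ (b≡0 , _)) = b≢0 b≡0
    disjoint₁₂ di _ (inj₁ (refl , i<A)) (inj₂ (_ , A≤i)) = ℕP.<-irrefl refl (ℕP.<-≤-trans i<A A≤i)
    disjoint₁₂ di _ (inj₂ (refl , A≤i)) (inj₁ (_ , i<A)) = ℕP.<-irrefl refl (ℕP.<-≤-trans i<A A≤i)
    disjoint₁₂ di _ (inj₂ (refl , _)) (inj₂ (0≡b , _)) = b≢0 (sym 0≡b)
    disjoint₁₂ cw _ (refl , _) (0≡a , _) = a≢0 (sym 0≡a)
    disjoint₁₂ ccw _ (refl , _) (a≡0 , _) = a≢0 a≡0

    disjoint₁₃ : Disjoint L₁ L₃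
    disjoint₁₃ di _ (inj₁ (refl , _)) b≡last = b≢last b≡last
    disjoint₁₃ di _ (inj₂ (refl , _)) ()
    disjoint₁₃ cw _ (refl , j<B) (inj₁ (_ , refl)) =
      ℕP.<-irrefl refl (ℕP.<-trans (subst (_< B) (toℕ-fromℕ _) j<B) b<last)
    disjoint₁₃ cw _ (refl , j<B) (inj₂ (_ , B≤j , _)) = ℕP.<-irrefl refl (ℕP.<-≤-trans j<B B≤j)
    disjoint₁₃ ccw _ (refl , _) (inj₁ (a≡0 , _)) = a≢0 a≡0
    disjoint₁₃ ccw _ (refl , _ , j≤B) (inj₂ (_ , B<j)) = ℕP.<-irrefl refl (ℕP.<-≤-trans B<j j≤B)

    disjoint₂₃ : Disjoint L₂ L₃
    disjoint₂₃ di _ (inj₁ (refl , _)) ()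
    disjoint₂₃ di _ (inj₂ (refl , _)) b≡last = b≢last b≡last
    disjoint₂₃ cw _ (refl , _) (inj₁ (a≡0 , _)) = a≢0 a≡0
    disjoint₂₃ cw _ (refl , j<B) (inj₂ (_ , B≤j , _)) = ℕP.<-irrefl refl (ℕP.<-≤-trans j<B B≤j)
    disjoint₂₃ ccw _ (refl , () , _) (inj₁ (_ , refl))
    disjoint₂₃ ccw _ (refl , _) (inj₂ (0≡a , _)) = a≢0 (sym 0≡a)

    packing : HasPacking D (Pair {D} origin (a , b)) 3
    packing = packing-of-three H₁ H₂ H₃ disjoint₁₂ disjoint₁₃ disjoint₂₃

  di-shift : ArcPreservingBijection D
  di-shift = record
    { to = λ (i , j) → next i , j
    ; from = λ (i , j) → prev i , j
    ; from-to = λ (i , j) → cong (_, j) (prev-next i)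
    ; to-from = λ (i , j) → cong (_, j) (next-prev i)
    ; to-arc = λ { (inj₁ (arc , j≡j′)) → inj₁ (next-preserves-arc arc , j≡j′)
                 ; (inj₂ (i≡i′ , arc)) → inj₂ (cong next i≡i′ , arc) }
    }

  cw-shift : ArcPreservingBijection D
  cw-shift = record
    { to = λ (i , j) → i , next j
    ; from = λ (i , j) → i , prev j
    ; from-to = λ (i , j) → cong (i ,_) (prev-next j)
    ; to-from = λ (i , j) → cong (i ,_) (next-prev j)
    ; to-arc = λ { (inj₁ (arc , j≡j′)) → inj₁ (arc , cong next j≡j′)
                 ; (inj₂ (i≡i′ , inj₁ arc)) → inj₂ (i≡i′ , inj₁ (next-preserves-arc arc))
                 ; (inj₂ (i≡i′ , inj₂ arc)) → inj₂ (i≡i′ , inj₂ (next-preserves-arc arc)) }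
    }

  reflection : ArcPreservingBijection D
  reflection = record
    { to = λ (i , j) → i , negate j
    ; from = λ (i , j) → i , negate j
    ; from-to = λ (i , j) → cong (i ,_) (negate-involutive j)
    ; to-from = λ (i , j) → cong (i ,_) (negate-involutive j)
    ; to-arc = λ { (inj₁ (arc , j≡j′)) → inj₁ (arc , cong negate j≡j′)
                 ; (inj₂ (i≡i′ , inj₁ arc)) → inj₂ (i≡i′ , inj₂ (negate-reverses-arc arc))
                 ; (inj₂ (i≡i′ , inj₂ arc)) → inj₂ (i≡i′ , inj₁ (negate-reverses-arc arc)) }
    }

  packing-from-origin : ∀ y → HasPacking D (Pair {D} origin y) 3
  packing-from-origin (a , b) with a ≟ᶠ fz | b ≟ᶠ fz | toℕ b ℕ.<? suc (suc M)
  ... | yes refl | _ | _ = SameRow.packing b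
  ... | no _ | yes refl | _ = SameColumn.packing a
  ... | no a≢0 | no b≢0 | yes b<last = Generic.packing a b a≢0 b≢0 b<last
  ... | no a≢0 | no _ | no b≮last =
    subst₂ (λ u v → HasPacking D (Pair {D} u v) 3) (cong (fz ,_) negate-zero) (cong (a ,_) (trans negate-one (sym b≡last)))
      (image-packing reflection (Generic.packing a (fs fz) a≢0 (λ ()) (s≤s (s≤s z≤n))))
    where
    b≡last : b ≡ last-column
    b≡last = toℕ-injective (trans (ℕP.≤-antisym (toℕ≤pred b) (ℕP.≮⇒≥ b≮last)) (sym (toℕ-fromℕ _)))

  packing : ∀ x y → HasPacking D (Pair {D} x y) 3
  packing (i , j) = cycle-induction (λ i → ∀ y → HasPacking D (Pair {D} (i , j) y) 3)
    (cycle-induction (λ j → ∀ y → HasPacking D (Pair {D} (fz , j) y) 3) packing-from-origin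
      (λ _ → image-packings-from cw-shift) j)
    (λ _ → image-packings-from di-shift) i

proposition5p2 : ∀ n m → 2 ≤ n → 3 ≤ m → IsLambda2 (DiCycle n □ SymCycle m) 3
proposition5p2 _ _ (s≤s (s≤s (z≤n {N}))) (s≤s (s≤s (s≤s (z≤n {M})))) =
  isLambda2-uniform _ packing packing-size≤3 (origin , (fs fz , fz) , λ ())
  where open Torus N M
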